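{- Let $k\ge 3$ and $m\ge 2$ be integers and let $\mathcal{H}$ be a unicyclic $k$-uniform hypergraph on $n$ vertices with $m=\frac{n}{k-1}$ edges. Then: (a) $h(\mathcal{H})\ge 2m\log 2$, with equality if and only if the maximum vertex degree of $\mathcal{H}$ is $2$; (b) $h(\mathcal{H})\le m\log m+2\log 2$, with equality if and only if $\mathcal{H}\cong\mathcal{H}^{II}$.
   Context: All logarithms are to base $2$. A $k$-uniform hypergraph consists of a finite vertex set and a set of distinct edges, each a $k$-element subset of the vertex set; the degree $d_v$ of a vertex is the number of edges containing it. A walk is a sequence $v_0e_1v_1\cdots e_lv_l$ with $\{v_{i-1},v_i\}\subseteq e_i$; connected means any two vertices are joined by a walk; a cycle is a walk with $l\ge2$, $v_0=v_l$ and no other repeated vertices or edges. A unicyclic hypergraph is a connected hypergraph containing exactly one cycle; equivalently, a connected $k$-uniform hypergraph with $n$ vertices and $m$ edges is unicyclic iff $m(k-1)=n$. $\mathcal{H}^{II}$ denotes the $k$-uniform hypergraph with $m$ edges $e_1,\dots,e_m$ in which a vertex $v$ lies in every edge, a second vertex $w\ne v$ lies in exactly $e_1$ and $e_2$, and every other vertex lies in exactly one edge. For a hypergraph with vertex degrees $d_1,\dots,d_n$, $h(\mathcal{H})=\sum_{i=1}^n d_i\log d_i$. -}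

module Defs where

open import Data.Nat using (ℕ; zero; suc; _+_; _*_; _^_; _≤_)
open import Data.Fin using (Fin)
open import Data.Fin.Subset as S using (Subset; inside; outside; ∣_∣) renaming (_∈_ to _∈ˢ_)
open import Data.Vec using (lookup)
open import Data.List using (List; []; _∷_; length; map; allFin)
open import Data.Nat.ListAction using (sum; product)
open import Data.List.Relation.Unary.Unique.Propositional using (Unique)
open import Data.List.Membership.Propositional using (_∈_)
open import Data.Bool using (Bool; true; false; if_then_else_)
open import Data.Product using (Σ; _×_; ∃; ∃-syntax)
open import Data.Sum using (_⊎_)
open import Function.Bundles using (_⇔_)
open import Relation.Binary.PropositionalEquality using (_≡_; _≢_)

record Hypergraph (n m k : ℕ) : Set where
  field
    edge     : Fin m → Subset n
    uniform  : ∀ e → ∣ edge e ∣ ≡ k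
    distinct : ∀ e e′ → edge e ≡ edge e′ → e ≡ e′

module _ {n m k : ℕ} (H : Hypergraph n m k) where
  open Hypergraph H

  _∈ₑ_ : Fin n → Fin m → Set
  v ∈ₑ e = v ∈ˢ edge e

  deg : Fin n → ℕ
  deg v = sum (map (λ e → if lookup (edge e) v then 1 else 0) (allFin m))

  data Walk : Fin n → Fin n → Set where
    []   : ∀ {v} → Walk v v
    step : ∀ {u v w} (e : Fin m) → u ∈ₑ e → v ∈ₑ e → Walk v w → Walk u w

  wlength : ∀ {u w} → Walk u w → ℕ
  wlength []                 = 0
  wlength (step _ _ _ p)     = suc (wlength p)

  wedges : ∀ {u w} → Walk u w → List (Fin m)
  wedges []                  = []
  wedges (step e _ _ p)      = e ∷ wedges p

  wtail : ∀ {u w} → Walk u w → List (Fin n)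
  wtail []                           = []
  wtail (step {v = v} _ _ _ p)       = v ∷ wtail p

  Connected : Set
  Connected = ∀ u v → Walk u v

  -- a cycle: closed walk of length ≥ 2 with no repeated edges and no
  -- repeated vertices other than v₀ = v_l
  record Cycle : Set where
    field
      base      : Fin n
      walk      : Walk base base
      long      : 2 ≤ wlength walk
      edgesUniq : Unique (wedges walk)
      vertsUniq : Unique (wtail walk)

  -- two cycles are the same cycle iff they have the same vertices and edges
  -- (i.e. they differ only by rotation / reversal of the walk)
  SameCycle : Cycle → Cycle → Set
  SameCycle c c′ =
    (∀ v → v ∈ wtail (Cycle.walk c) ⇔ v ∈ wtail (Cycle.walk c′)) ×
    (∀ e → e ∈ wedges (Cycle.walk c) ⇔ e ∈ wedges (Cycle.walk c′))

  Unicyclic : Set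
  Unicyclic = Connected × Cycle × (∀ c c′ → SameCycle c c′)

  -- 2 ^ h(H) = ∏_v d_v ^ d_v  (with 0^0 = 1 matching 0 log 0 = 0)
  exp2h : ℕ
  exp2h = product (map (λ v → deg v ^ deg v) (allFin n))

  MaxDegreeIs : ℕ → Set
  MaxDegreeIs d = (∀ v → deg v ≤ d) × ∃[ v ] deg v ≡ d

  -- H ≅ H^II : there is a vertex v in every edge, a vertex w ≠ v lying in
  -- exactly two edges e₁ ≠ e₂, and every other vertex lies in exactly one edge.
  IsHII : Set
  IsHII = ∃[ v ] ∃[ w ] ∃[ e₁ ] ∃[ e₂ ]
    (w ≢ v) × (e₁ ≢ e₂) × (∀ e → v ∈ₑ e) ×
    (∀ e → (w ∈ₑ e) ⇔ (e ≡ e₁ ⊎ e ≡ e₂)) ×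
    (∀ u → u ≢ v → u ≢ w → deg u ≡ 1)

{-# OPTIONS --safe #-}
module Submission where

-- Write every degree as d = 1 + x. Connectivity makes all degrees positive, and double counting
-- incidences together with n = m (k - 1) gives Σ x = m, so 2 ^ h = ∏ (1 + x) ^ (1 + x) is a function
-- of excesses x ≤ m - 1 with sum m.
-- (a) Termwise (1 + x) ^ (1 + x) ≥ 4 ^ x, with equality exactly when x ≤ 1.
-- (b) f x = (1 + x) ^ (1 + x) satisfies f a * f b ≤ f (a + b), strictly when a, b ≥ 1. Merging all
-- excesses except one nonzero a bounds 2 ^ h by f a * f b with b = m - a ≥ 1, and for a, b ≥ 1
-- f a * f b ≤ 4 * f (a + b - 1) = 4 m ^ m, strictly unless a = 1 or b = 1. Hence equality forces the
-- excesses m - 1, 1, 0, …, 0, the degree sequence of H^II. Both estimates on f are Bernoulli-type lower bounds for (1 + t / c) ^ N.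

open import Defs
open import Data.Nat using (ℕ; _*_; _∸_; _^_; _≤_)
open import Data.Product using (_×_)
open import Function.Bundles using (_⇔_)
open import Relation.Binary.PropositionalEquality using (_≡_)

open import Data.Nat
open import Data.Nat.Properties
open import Data.Nat.Tactic.RingSolver using (solve-∀)
open import Data.Bool using (Bool; if_then_else_)
open import Data.Fin using (Fin; zero; suc; punchIn; punchOut)
open import Data.Fin.Properties as Fin using (punchInᵢ≢i; punchIn-injective; punchIn-punchOut)
open import Data.Fin.Subset using (Subset; inside; outside; ∣_∣; ⊥; ⁅_⁆; _∪_; _∈_)
open import Data.Fin.Subset.Properties
  using (∣p∣≡n⇒p≡⊤; ∣⊤∣≡n; ∈⊤; ⊆⊤; ⊆-antisym; ∣⁅x⁆∣≡1; ∪-identityˡ; ∪-identityʳ; x∈⁅y⁆⇔x≡y; ∪⇔⊎;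
         ∣p∣≤n; x∈p⇒∣p-x∣<∣p∣)
open import Data.List as List using (allFin)
open import Data.List.Properties using (map-tabulate)
open import Data.Vec using ([]; _∷_; lookup; tabulate)
open import Data.Vec.Properties using (lookup∘tabulate; []=⇒lookup; lookup⇒[]=)
open import Data.Vec.Functional as Vector using (Vector; tail; removeAt)
open import Data.Product using (_,_; ∃; ∃₂; proj₁; proj₂)
open import Data.Sum using (_⊎_; inj₁; inj₂)
open import Data.Sum.Function.Propositional using (_⊎-⇔_)
open import Function using (_∘_; id)
open import Function.Bundles using (mk⇔; Equivalence)
import Function.Properties.Equivalence as ⇔
open import Relation.Binary.PropositionalEquality
open import Relation.Nullary using (contradiction; yes; no)
open import Algebra.Properties.CommutativeMonoid.Sum +-0-commutativeMonoid
  using (∑-comm; ∑-distrib-+; sum-syntax) renaming (sum to ∑; sum-cong-≗ to ∑-cong)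
open import Algebra.Properties.CommutativeMonoid.Sum *-1-commutativeMonoid
  using () renaming (sum to ∏; sum-cong-≗ to ∏-cong; sum-remove to ∏-remove; sum-replicate-zero to ∏-replicate-1)

open Equivalence using (to; from)

private
  variable
    n : ℕ

*-mono-≤-equality : ∀ {a b c d} → 0 < a → 0 < b → a ≤ c → b ≤ d → a * b ≡ c * d → a ≡ c × b ≡ d
*-mono-≤-equality {a} {b} {c} {d} a>0 b>0 a≤c b≤d eq =
  a≡c , *-cancelˡ-≡ b d a {{>-nonZero a>0}} (trans eq (cong (_* d) (sym a≡c)))
  where
  a≡c : a ≡ c
  a≡c = ≤-antisym a≤c (*-cancelʳ-≤ c a b {{>-nonZero b>0}} (≤-trans (*-monoʳ-≤ c b≤d) (≤-reflexive (sym eq))))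

≤-<-*-mono : ∀ {x X y Y} → 0 < X → x ≤ X → y < Y → x * y < X * Y
≤-<-*-mono {x} {X} {y} X>0 x≤X y<Y = ≤-<-trans (*-monoˡ-≤ y x≤X) (*-monoʳ-< X {{>-nonZero X>0}} y<Y)

squeeze : ∀ {a b c} → a ≤ b → b ≤ c → a ≡ c → a ≡ b × b ≡ c
squeeze a≤b b≤c refl = ≤-antisym a≤b b≤c , ≤-antisym b≤c a≤b

positive-remainder : ∀ {a t s} → suc a + t ≡ suc s → suc a ≤ s → ∃ λ b → t ≡ suc b × s ≡ suc (a + b)
positive-remainder {a} {zero} eq a<s = contradiction (trans (sym (+-identityʳ a)) (suc-injective eq)) (<⇒≢ a<s)
positive-remainder {a} {suc b} eq _ = b , refl , trans (sym (suc-injective eq)) (+-suc a b)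

≡-resp-⇔ : ∀ {A : Set} {a a′ b b′ : A} → a ≡ a′ → b ≡ b′ → (a ≡ b) ⇔ (a′ ≡ b′)
≡-resp-⇔ refl refl = ⇔.refl

-- The function x ↦ (1 + x) ^ (1 + x)

-- The factor d ^ d contributed to 2 ^ h by a vertex of degree d = 1 + x.
selfPow : ℕ → ℕ
selfPow x = suc x ^ suc x

selfPow>0 : ∀ x → 0 < selfPow x
selfPow>0 x = m^n>0 (suc x) (suc x)

-- (1 + t/c)ⁿ ≥ 1 + n t/c, cleared of denominators
bernoulli : ∀ c t n → c ^ n * (c + n * t) ≤ c * (c + t) ^ n
bernoulli c t zero = ≤-reflexive (base c t)
  where
  base : ∀ c t → 1 * (c + 0 * t) ≡ c * 1
  base = solve-∀
bernoulli c t (suc n) = begin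
  c * c ^ n * (c + suc n * t)                        ≤⟨ m≤m+n _ _ ⟩
  c * c ^ n * (c + suc n * t) + c ^ n * (n * t * t)  ≡⟨ expand c t n (c ^ n) ⟩
  (c + t) * (c ^ n * (c + n * t))                    ≤⟨ *-monoʳ-≤ (c + t) (bernoulli c t n) ⟩
  (c + t) * (c * (c + t) ^ n)                        ≡⟨ regroup c t ((c + t) ^ n) ⟩
  c * (c + t) ^ suc n                                ∎
  where
  open ≤-Reasoning
  expand : ∀ c t n p → c * p * (c + suc n * t) + p * (n * t * t) ≡ (c + t) * (p * (c + n * t))
  expand = solve-∀
  regroup : ∀ c t q → (c + t) * (c * q) ≡ c * ((c + t) * q)
  regroup = solve-∀

-- (1 + t/c)ᴺ ≥ 1 + N t/c + (N choose 2) (t/c)² for N = suc n, cleared of denominators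
bernoulli₂ : ∀ c t n →
  c ^ suc n * (2 * c * c + 2 * suc n * c * t + suc n * n * t * t) ≤ 2 * c * c * (c + t) ^ suc n
bernoulli₂ c t zero = ≤-reflexive (base c t)
  where
  base : ∀ c t → c * 1 * (2 * c * c + 2 * 1 * c * t + 1 * 0 * t * t) ≡ 2 * c * c * ((c + t) * 1)
  base = solve-∀
bernoulli₂ c t (suc n) = begin
  c * p * B (suc (suc n))                                 ≤⟨ m≤m+n _ _ ⟩
  c * p * B (suc (suc n)) + p * (suc n * n * t * t * t)  ≡⟨ expand c t n p ⟩
  (c + t) * (p * B (suc n))                               ≤⟨ *-monoʳ-≤ (c + t) (bernoulli₂ c t n) ⟩
  (c + t) * (2 * c * c * (c + t) ^ suc n)                 ≡⟨ regroup c t ((c + t) ^ suc n) ⟩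
  2 * c * c * (c + t) ^ suc (suc n)                       ∎
  where
  open ≤-Reasoning
  p = c ^ suc n
  B : ℕ → ℕ
  B N = 2 * c * c + 2 * N * c * t + N * pred N * t * t
  expand : ∀ c t n p →
    c * p * (2 * c * c + 2 * suc (suc n) * c * t + suc (suc n) * suc n * t * t) + p * (suc n * n * t * t * t)
      ≡ (c + t) * (p * (2 * c * c + 2 * suc n * c * t + suc n * n * t * t))
  expand = solve-∀
  regroup : ∀ c t q → (c + t) * (2 * c * c * q) ≡ 2 * c * c * ((c + t) * q)
  regroup = solve-∀

4^x<selfPow : ∀ x → 2 ≤ x → 4 ^ x < selfPow x
4^x<selfPow (suc zero) (s≤s ())
4^x<selfPow (suc (suc zero)) _ = ≤ᵇ⇒≤ 17 27 _
4^x<selfPow (suc (suc (suc x))) _ = begin-strict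
  4 * 4 ^ (2 + x)             <⟨ *-monoʳ-< 4 (4^x<selfPow (suc (suc x)) (s≤s (s≤s z≤n))) ⟩
  4 * selfPow (2 + x)         ≤⟨ *-monoˡ-≤ (selfPow (2 + x)) (m≤m+n 4 x) ⟩
  (4 + x) * (3 + x) ^ (3 + x) ≤⟨ *-monoʳ-≤ (4 + x) (^-monoˡ-≤ (3 + x) (n≤1+n (3 + x))) ⟩
  selfPow (3 + x)             ∎
  where open ≤-Reasoning

4^x≤selfPow : ∀ x → 4 ^ x ≤ selfPow x
4^x≤selfPow zero = ≤-refl
4^x≤selfPow (suc zero) = ≤-refl
4^x≤selfPow x@(suc (suc _)) = <⇒≤ (4^x<selfPow x (s≤s (s≤s z≤n)))

4^x≡selfPow⇒x≤1 : ∀ x → 4 ^ x ≡ selfPow x → x ≤ 1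
4^x≡selfPow⇒x≤1 x eq with x ≤? 1
... | yes x≤1 = x≤1
... | no x≰1 = contradiction eq (<⇒≢ (4^x<selfPow x (≰⇒> x≰1)))

x≤1⇒selfPow≡4^x : ∀ {x} → x ≤ 1 → selfPow x ≡ 4 ^ x
x≤1⇒selfPow≡4^x z≤n = refl
x≤1⇒selfPow≡4^x (s≤s z≤n) = refl

private
  absorb-factor : ∀ a b → suc a ^ suc a * suc b ≤ (suc a + b) ^ suc a
  absorb-factor a b = *-cancelˡ-≤ (suc a) (begin
    suc a * (suc a ^ suc a * suc b)     ≡⟨ regroup (suc a) (suc a ^ suc a) b ⟩
    suc a ^ suc a * (suc a + suc a * b) ≤⟨ bernoulli (suc a) b (suc a) ⟩
    suc a * (suc a + b) ^ suc a         ∎)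
    where
    open ≤-Reasoning
    regroup : ∀ c p b → c * (p * suc b) ≡ p * (c + c * b)
    regroup = solve-∀

  -- With c = 2 + a, bernoulli₂ gives (1 + b/c)^c ≥ 1 + b + (c - 1) b²/(2c), and (c - 1)/(2c) ≥ 1/4
  -- as c ≥ 2; the dropped slack term is 2 c a b² c^c.
  absorb-square : ∀ a b → (2 + a) ^ (2 + a) * ((2 + b) * (2 + b)) ≤ 4 * (2 + a + b) ^ (2 + a)
  absorb-square a b = *-cancelˡ-≤ (2 * c * c) (begin
    2 * c * c * (p * ((2 + b) * (2 + b)))                          ≤⟨ m≤m+n _ _ ⟩
    2 * c * c * (p * ((2 + b) * (2 + b))) + 2 * c * a * b * b * p  ≡⟨ expand a b p ⟩
    4 * (p * (2 * c * c + 2 * c * c * b + c * suc a * b * b))      ≤⟨ *-monoʳ-≤ 4 (bernoulli₂ c b (suc a)) ⟩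
    4 * (2 * c * c * (c + b) ^ c)                                  ≡⟨ regroup (2 * c * c) ((c + b) ^ c) ⟩
    2 * c * c * (4 * (c + b) ^ c)                                  ∎)
    where
    open ≤-Reasoning
    c = 2 + a
    p = c ^ c
    expand : ∀ a b p →
      2 * (2 + a) * (2 + a) * (p * ((2 + b) * (2 + b))) + 2 * (2 + a) * a * b * b * p
        ≡ 4 * (p * (2 * (2 + a) * (2 + a) + 2 * (2 + a) * (2 + a) * b + (2 + a) * suc a * b * b))
    expand = solve-∀
    regroup : ∀ k q → 4 * (k * q) ≡ k * (4 * q)
    regroup = solve-∀

  pull-square : ∀ p u q → p * (u * (u * q)) ≡ p * (u * u) * q
  pull-square = solve-∀

  join-powers : ∀ k u i j → k * u ^ i * u ^ j ≡ k * u ^ (i + j)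
  join-powers k u i j = trans (*-assoc k _ _) (cong (k *_) (sym (^-distribˡ-+-* u i j)))

selfPow-superadditive : ∀ a b → selfPow a * selfPow b ≤ selfPow (a + b)
selfPow-superadditive a b = begin
  suc a ^ suc a * (suc b * suc b ^ b)   ≡⟨ *-assoc (suc a ^ suc a) (suc b) _ ⟨
  suc a ^ suc a * suc b * suc b ^ b     ≤⟨ *-mono-≤ (absorb-factor a b) (^-monoˡ-≤ b (s≤s (m≤n+m b a))) ⟩
  (suc a + b) ^ suc a * (suc a + b) ^ b ≡⟨ ^-distribˡ-+-* (suc a + b) (suc a) b ⟨
  selfPow (a + b)                       ∎
  where open ≤-Reasoning

selfPow-superadditive-equality : ∀ a b → selfPow a * selfPow b ≡ selfPow (a + b) → a ≡ 0 ⊎ b ≡ 0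
selfPow-superadditive-equality zero b _ = inj₁ refl
selfPow-superadditive-equality (suc a) zero _ = inj₂ refl
selfPow-superadditive-equality (suc a) (suc b) eq = contradiction eq (<⇒≢ (begin-strict
  c ^ c * (suc (suc b) * suc (suc b) ^ suc b) ≡⟨ *-assoc (c ^ c) (suc (suc b)) _ ⟨
  c ^ c * suc (suc b) * suc (suc b) ^ suc b   <⟨ ≤-<-*-mono (m^n>0 (c + suc b) c) (absorb-factor (suc a) (suc b))
                                                   (^-monoˡ-< (suc b) (s≤s (s≤s (m≤n+m (suc b) a)))) ⟩
  (c + suc b) ^ c * (c + suc b) ^ suc b       ≡⟨ ^-distribˡ-+-* (c + suc b) c (suc b) ⟨
  selfPow (suc a + suc b)                     ∎))
  where
  open ≤-Reasoning
  c = suc (suc a)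

selfPow-merge : ∀ a b → selfPow (suc a) * selfPow (suc b) ≤ 4 * selfPow (suc (a + b))
selfPow-merge a b = begin
  (2 + a) ^ (2 + a) * ((2 + b) * ((2 + b) * (2 + b) ^ b))  ≡⟨ pull-square ((2 + a) ^ (2 + a)) (2 + b) _ ⟩
  (2 + a) ^ (2 + a) * ((2 + b) * (2 + b)) * (2 + b) ^ b    ≤⟨ *-mono-≤ (absorb-square a b)
                                                                (^-monoˡ-≤ b (+-monoˡ-≤ b (s≤s (s≤s z≤n)))) ⟩
  4 * (2 + a + b) ^ (2 + a) * (2 + a + b) ^ b              ≡⟨ join-powers 4 (2 + a + b) (2 + a) b ⟩
  4 * selfPow (suc (a + b))                                ∎
  where open ≤-Reasoning

selfPow-merge-equality : ∀ a b → selfPow (suc a) * selfPow (suc b) ≡ 4 * selfPow (suc (a + b)) → a ≡ 0 ⊎ b ≡ 0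
selfPow-merge-equality zero b _ = inj₁ refl
selfPow-merge-equality (suc a) zero _ = inj₂ refl
selfPow-merge-equality (suc a) (suc b) eq = contradiction eq (<⇒≢ (begin-strict
  c ^ c * ((3 + b) * ((3 + b) * (3 + b) ^ suc b)) ≡⟨ pull-square (c ^ c) (3 + b) _ ⟩
  c ^ c * ((3 + b) * (3 + b)) * (3 + b) ^ suc b   <⟨ ≤-<-*-mono (*-monoʳ-< 4 (m^n>0 (c + suc b) c))
                                                       (absorb-square (suc a) (suc b))
                                                       (^-monoˡ-< (suc b) (+-monoˡ-< (suc b) (s≤s (s≤s (s≤s z≤n))))) ⟩
  4 * (c + suc b) ^ c * (c + suc b) ^ suc b       ≡⟨ join-powers 4 (c + suc b) c (suc b) ⟩
  4 * selfPow (suc (suc a + suc b))               ∎))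
  where
  open ≤-Reasoning
  c = 3 + a

foldr-map-allFin : ∀ {A B : Set} (_∙_ : A → B → B) ε (f : Vector A n) →
  List.foldr _∙_ ε (List.map f (allFin n)) ≡ Vector.foldr _∙_ ε f
foldr-map-allFin {A = A} _∙_ ε f = trans (cong (List.foldr _∙_ ε) (map-tabulate id f)) (foldr-tabulate f)
  where
  foldr-tabulate : ∀ {n} (f : Vector A n) → List.foldr _∙_ ε (List.tabulate f) ≡ Vector.foldr _∙_ ε f
  foldr-tabulate {zero} f = refl
  foldr-tabulate {suc n} f = cong (f zero ∙_) (foldr-tabulate (f ∘ suc))

∑-const : ∀ k → ∑ {n} (λ _ → k) ≡ n * k
∑-const {zero} k = refl
∑-const {suc n} k = cong (k +_) (∑-const {n} k)

∑-suc : (x : Vector ℕ n) → ∑ (λ i → suc (x i)) ≡ n + ∑ x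
∑-suc {n} x = trans (∑-distrib-+ (λ _ → 1) x) (cong (_+ ∑ x) (trans (∑-const {n} 1) (*-identityʳ n)))

∑≡0⇒≡0 : (x : Vector ℕ n) → ∑ x ≡ 0 → ∀ i → x i ≡ 0
∑≡0⇒≡0 x ∑≡0 zero = m+n≡0⇒m≡0 (x zero) ∑≡0
∑≡0⇒≡0 x ∑≡0 (suc i) = ∑≡0⇒≡0 (tail x) (m+n≡0⇒n≡0 (x zero) ∑≡0) i

∑>0⇒∃>0 : (x : Vector ℕ n) → 0 < ∑ x → ∃ λ i → 0 < x i
∑>0⇒∃>0 {suc n} x ∑>0 with x zero in x₀≡
... | suc _ = zero , subst (0 <_) (sym x₀≡) z<s
... | zero with i , xᵢ>0 ← ∑>0⇒∃>0 (tail x) ∑>0 = suc i , xᵢ>0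

∏-pos : {f : Vector ℕ n} → (∀ i → 0 < f i) → 0 < ∏ f
∏-pos {zero} f>0 = z<s
∏-pos {suc n} f>0 = *-mono-< (f>0 zero) (∏-pos (f>0 ∘ suc))

∏-mono-≤ : {f g : Vector ℕ n} → (∀ i → f i ≤ g i) → ∏ f ≤ ∏ g
∏-mono-≤ {zero} f≤g = ≤-refl
∏-mono-≤ {suc n} f≤g = *-mono-≤ (f≤g zero) (∏-mono-≤ (f≤g ∘ suc))

∏-mono-≤-equality : {f g : Vector ℕ n} → (∀ i → 0 < f i) → (∀ i → f i ≤ g i) → ∏ f ≡ ∏ g → ∀ i → f i ≡ g i
∏-mono-≤-equality {suc n} f>0 f≤g eq i
  with f₀≡g₀ , ∏≡ ← *-mono-≤-equality (f>0 zero) (∏-pos (f>0 ∘ suc)) (f≤g zero) (∏-mono-≤ (f≤g ∘ suc)) eq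
  with i
... | zero = f₀≡g₀
... | suc i = ∏-mono-≤-equality (f>0 ∘ suc) (f≤g ∘ suc) ∏≡ i

∏-^ : ∀ b (x : Vector ℕ n) → ∏ (λ i → b ^ x i) ≡ b ^ ∑ x
∏-^ {zero} b x = refl
∏-^ {suc n} b x = trans (cong (b ^ x zero *_) (∏-^ b (tail x))) (sym (^-distribˡ-+-* b (x zero) _))

∏-single : ∀ {j} (f : Vector ℕ n) → (∀ u → u ≢ j → f u ≡ 1) → ∏ f ≡ f j
∏-single {suc n} {j} f f≡1 = begin
  ∏ f                    ≡⟨ ∏-remove f ⟩
  f j * ∏ (removeAt f j) ≡⟨ cong (f j *_) (∏-cong {n} (λ u → f≡1 _ (punchInᵢ≢i j u))) ⟩
  f j * ∏ {n} (λ _ → 1)  ≡⟨ cong (f j *_) (∏-replicate-1 n) ⟩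
  f j * 1                ≡⟨ *-identityʳ (f j) ⟩
  f j                    ∎
  where open ≡-Reasoning

∏-pair : ∀ {v w} (f : Vector ℕ n) → v ≢ w → (∀ u → u ≢ v → u ≢ w → f u ≡ 1) → ∏ f ≡ f v * f w
∏-pair {suc n} {v} {w} f v≢w f≡1 = begin
  ∏ f                                ≡⟨ ∏-remove f ⟩
  f v * ∏ (removeAt f v)             ≡⟨ cong (f v *_) (∏-single (removeAt f v) rest≡1) ⟩
  f v * f (punchIn v (punchOut v≢w)) ≡⟨ cong (λ u → f v * f u) (punchIn-punchOut v≢w) ⟩
  f v * f w                          ∎
  where
  open ≡-Reasoning
  rest≡1 : ∀ u → u ≢ punchOut v≢w → f (punchIn v u) ≡ 1
  rest≡1 u u≢ = f≡1 _ (punchInᵢ≢i v u)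
    (λ eq → u≢ (punchIn-injective v u _ (trans eq (sym (punchIn-punchOut v≢w)))))

-- Products of selfPow over vectors of excesses

4^∑≤∏selfPow : (x : Vector ℕ n) → 4 ^ ∑ x ≤ ∏ (selfPow ∘ x)
4^∑≤∏selfPow x = subst (_≤ ∏ (selfPow ∘ x)) (∏-^ 4 x) (∏-mono-≤ (4^x≤selfPow ∘ x))

∏selfPow≡4^∑⇔≤1 : (x : Vector ℕ n) → ∏ (selfPow ∘ x) ≡ 4 ^ ∑ x ⇔ (∀ i → x i ≤ 1)
∏selfPow≡4^∑⇔≤1 x = mk⇔
  (λ eq i → 4^x≡selfPow⇒x≤1 (x i)
     (∏-mono-≤-equality (λ i → m^n>0 4 (x i)) (4^x≤selfPow ∘ x) (trans (∏-^ 4 x) (sym eq)) i))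
  (λ x≤1 → trans (∏-cong (x≤1⇒selfPow≡4^x ∘ x≤1)) (∏-^ 4 x))

∏selfPow≤selfPow∑ : (x : Vector ℕ n) → ∏ (selfPow ∘ x) ≤ selfPow (∑ x)
∏selfPow≤selfPow∑ {zero} x = ≤-refl
∏selfPow≤selfPow∑ {suc n} x =
  ≤-trans (*-monoʳ-≤ (selfPow (x zero)) (∏selfPow≤selfPow∑ (tail x))) (selfPow-superadditive (x zero) _)

∏selfPow≡selfPow∑⇒concentrated : (x : Vector ℕ n) → 0 < ∑ x → ∏ (selfPow ∘ x) ≡ selfPow (∑ x) →
  ∃ λ j → x j ≡ ∑ x × ∀ u → u ≢ j → x u ≡ 0
∏selfPow≡selfPow∑⇒concentrated {suc n} x ∑>0 eq
  with ∏≡ , merge≡ ← squeeze (*-monoʳ-≤ (selfPow (x zero)) (∏selfPow≤selfPow∑ (tail x)))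
                             (selfPow-superadditive (x zero) (∑ (tail x))) eq
  with selfPow-superadditive-equality (x zero) (∑ (tail x)) merge≡
... | inj₂ ∑y≡0 = zero , sym (trans (cong (x zero +_) ∑y≡0) (+-identityʳ _)) ,
  λ { zero 0≢0 → contradiction refl 0≢0 ; (suc u) _ → ∑≡0⇒≡0 (tail x) ∑y≡0 u }
... | inj₁ x₀≡0
  with j , yⱼ≡ , y≡0 ← ∏selfPow≡selfPow∑⇒concentrated (tail x) (subst (λ a → 0 < a + ∑ (tail x)) x₀≡0 ∑>0)
                         (*-cancelˡ-≡ _ _ (selfPow (x zero)) {{>-nonZero (selfPow>0 (x zero))}} ∏≡)
  = suc j , trans yⱼ≡ (cong (_+ ∑ (tail x)) (sym x₀≡0)) ,
    λ { zero _ → x₀≡0 ; (suc u) u≢j → y≡0 u (u≢j ∘ cong suc) }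

∏selfPow≤4*selfPow : ∀ s (x : Vector ℕ n) → ∑ x ≡ suc s → (∀ i → x i ≤ s) → ∏ (selfPow ∘ x) ≤ 4 * selfPow s
∏selfPow≤4*selfPow {suc n} s x ∑x≡ x≤s = byHead (x zero) (x≤s zero) ∑x≡
  where
  byHead : ∀ a → a ≤ s → a + ∑ (tail x) ≡ suc s → selfPow a * ∏ (selfPow ∘ tail x) ≤ 4 * selfPow s
  byHead zero _ ∑y≡ = subst (_≤ 4 * selfPow s) (sym (*-identityˡ _)) (∏selfPow≤4*selfPow s (tail x) ∑y≡ (x≤s ∘ suc))
  byHead (suc a) a<s ∑x≡ = let b , ∑y≡ , s≡ = positive-remainder ∑x≡ a<s in begin
    selfPow (suc a) * ∏ (selfPow ∘ tail x) ≤⟨ *-monoʳ-≤ (selfPow (suc a)) (∏selfPow≤selfPow∑ (tail x)) ⟩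
    selfPow (suc a) * selfPow (∑ (tail x)) ≡⟨ cong (λ t → selfPow (suc a) * selfPow t) ∑y≡ ⟩
    selfPow (suc a) * selfPow (suc b)      ≤⟨ selfPow-merge a b ⟩
    4 * selfPow (suc (a + b))              ≡⟨ cong (λ t → 4 * selfPow t) s≡ ⟨
    4 * selfPow s                          ∎
    where open ≤-Reasoning

∏selfPow-merge-equality : ∀ a b (y : Vector ℕ n) → ∑ y ≡ suc b →
  selfPow (suc a) * ∏ (selfPow ∘ y) ≡ 4 * selfPow (suc (a + b)) →
  (a ≡ 0 ⊎ b ≡ 0) × ∃ λ j → y j ≡ suc b × ∀ u → u ≢ j → y u ≡ 0
∏selfPow-merge-equality a b y ∑y≡ eq = selfPow-merge-equality a b (proj₂ squeezed) ,
  subst (λ t → ∃ λ j → y j ≡ t × ∀ u → u ≢ j → y u ≡ 0) ∑y≡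
    (∏selfPow≡selfPow∑⇒concentrated y (subst (0 <_) (sym ∑y≡) z<s) (trans ∏y≡ (cong selfPow (sym ∑y≡))))
  where
  ∏y≤ : selfPow (suc a) * ∏ (selfPow ∘ y) ≤ selfPow (suc a) * selfPow (suc b)
  ∏y≤ = *-monoʳ-≤ (selfPow (suc a)) (subst (λ t → ∏ (selfPow ∘ y) ≤ selfPow t) ∑y≡ (∏selfPow≤selfPow∑ y))
  squeezed : selfPow (suc a) * ∏ (selfPow ∘ y) ≡ selfPow (suc a) * selfPow (suc b)
           × selfPow (suc a) * selfPow (suc b) ≡ 4 * selfPow (suc (a + b))
  squeezed = squeeze ∏y≤ (selfPow-merge a b) eq
  ∏y≡ : ∏ (selfPow ∘ y) ≡ selfPow (suc b)
  ∏y≡ = *-cancelˡ-≡ _ _ (selfPow (suc a)) {{>-nonZero (selfPow>0 (suc a))}} (proj₁ squeezed)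

-- The excesses of H^II with suc s edges.
HIIProfile : ℕ → Vector ℕ n → Set
HIIProfile s x = ∃₂ λ v w → v ≢ w × x v ≡ s × x w ≡ 1 × ∀ u → u ≢ v → u ≢ w → x u ≡ 0

HIIProfile⇒∏selfPow≡ : ∀ s (x : Vector ℕ n) → HIIProfile s x → ∏ (selfPow ∘ x) ≡ 4 * selfPow s
HIIProfile⇒∏selfPow≡ s x (v , w , v≢w , xᵥ≡s , x_w≡1 , x≡0) = begin
  ∏ (selfPow ∘ x)               ≡⟨ ∏-pair (selfPow ∘ x) v≢w (λ u u≢v u≢w → cong selfPow (x≡0 u u≢v u≢w)) ⟩
  selfPow (x v) * selfPow (x w) ≡⟨ cong₂ (λ a b → selfPow a * selfPow b) xᵥ≡s x_w≡1 ⟩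
  selfPow s * 4                 ≡⟨ *-comm (selfPow s) 4 ⟩
  4 * selfPow s                 ∎
  where open ≡-Reasoning

HIIProfile-byHead : ∀ {s a b} (x : Vector ℕ (suc n)) → x zero ≡ suc a → s ≡ suc (a + b) → a ≡ 0 ⊎ b ≡ 0 →
  (∃ λ j → tail x j ≡ suc b × ∀ u → u ≢ j → tail x u ≡ 0) → HIIProfile s x
HIIProfile-byHead x x₀≡1 refl (inj₁ refl) (j , yⱼ≡ , y≡0) =
  suc j , zero , (λ ()) , yⱼ≡ , x₀≡1 ,
  λ { zero _ 0≢0 → contradiction refl 0≢0 ; (suc u) u≢v _ → y≡0 u (u≢v ∘ cong suc) }
HIIProfile-byHead {a = a} x x₀≡ refl (inj₂ refl) (j , yⱼ≡1 , y≡0) =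
  zero , suc j , (λ ()) , trans x₀≡ (cong suc (sym (+-identityʳ a))) , yⱼ≡1 ,
  λ { zero 0≢0 _ → contradiction refl 0≢0 ; (suc u) _ u≢w → y≡0 u (u≢w ∘ cong suc) }

∏selfPow≡4*selfPow⇒HIIProfile : ∀ s (x : Vector ℕ n) → ∑ x ≡ suc s → (∀ i → x i ≤ s) →
  ∏ (selfPow ∘ x) ≡ 4 * selfPow s → HIIProfile s x
∏selfPow≡4*selfPow⇒HIIProfile {suc n} s x ∑x≡ x≤s eq = byHead (x zero) refl (x≤s zero) ∑x≡ eq
  where
  byHead : ∀ a → x zero ≡ a → a ≤ s → a + ∑ (tail x) ≡ suc s →
           selfPow a * ∏ (selfPow ∘ tail x) ≡ 4 * selfPow s → HIIProfile s x
  byHead zero x₀≡0 _ ∑y≡ eq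
    with v , w , v≢w , xᵥ≡s , x_w≡1 , x≡0 ← ∏selfPow≡4*selfPow⇒HIIProfile s (tail x) ∑y≡ (x≤s ∘ suc)
                                                (trans (sym (*-identityˡ _)) eq)
    = suc v , suc w , v≢w ∘ Fin.suc-injective , xᵥ≡s , x_w≡1 ,
      λ { zero _ _ → x₀≡0 ; (suc u) u≢v u≢w → x≡0 u (u≢v ∘ cong suc) (u≢w ∘ cong suc) }
  byHead (suc a) x₀≡ a<s ∑x≡ eq =
    let b , ∑y≡ , s≡ = positive-remainder ∑x≡ a<s
        a≡0⊎b≡0 , concentrated = ∏selfPow-merge-equality a b (tail x) ∑y≡ (trans eq (cong (λ t → 4 * selfPow t) s≡))
    in HIIProfile-byHead x x₀≡ s≡ a≡0⊎b≡0 concentrated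

∏selfPow≡4*selfPow⇔HIIProfile : ∀ s (x : Vector ℕ n) → ∑ x ≡ suc s → (∀ i → x i ≤ s) →
  ∏ (selfPow ∘ x) ≡ 4 * selfPow s ⇔ HIIProfile s x
∏selfPow≡4*selfPow⇔HIIProfile s x ∑x≡ x≤s =
  mk⇔ (∏selfPow≡4*selfPow⇒HIIProfile s x ∑x≡ x≤s) (HIIProfile⇒∏selfPow≡ s x)

χ : Bool → ℕ
χ b = if b then 1 else 0

∣p∣≡∑χ : (p : Subset n) → ∣ p ∣ ≡ ∑ (χ ∘ lookup p)
∣p∣≡∑χ [] = refl
∣p∣≡∑χ (inside ∷ p) = cong suc (∣p∣≡∑χ p)
∣p∣≡∑χ (outside ∷ p) = ∣p∣≡∑χ p

∣p∣≡n⇔∀∈ : {p : Subset n} → ∣ p ∣ ≡ n ⇔ (∀ x → x ∈ p)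
∣p∣≡n⇔∀∈ {n} {p} = mk⇔
  (λ ∣p∣≡n x → subst (x ∈_) (sym (∣p∣≡n⇒p≡⊤ ∣p∣≡n)) ∈⊤)
  (λ ∀∈ → trans (cong ∣_∣ (⊆-antisym ⊆⊤ (λ {x} _ → ∀∈ x))) (∣⊤∣≡n n))

∣p∣≡0⇒p≡⊥ : {p : Subset n} → ∣ p ∣ ≡ 0 → p ≡ ⊥
∣p∣≡0⇒p≡⊥ {p = []} _ = refl
∣p∣≡0⇒p≡⊥ {p = outside ∷ p} ∣p∣≡0 = cong (outside ∷_) (∣p∣≡0⇒p≡⊥ ∣p∣≡0)

∣p∣≡1⇒p≡⁅x⁆ : {p : Subset n} → ∣ p ∣ ≡ 1 → ∃ λ x → p ≡ ⁅ x ⁆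
∣p∣≡1⇒p≡⁅x⁆ {p = inside ∷ p} ∣p∣≡1 = zero , cong (inside ∷_) (∣p∣≡0⇒p≡⊥ (suc-injective ∣p∣≡1))
∣p∣≡1⇒p≡⁅x⁆ {p = outside ∷ p} ∣p∣≡1 with x , refl ← ∣p∣≡1⇒p≡⁅x⁆ {p = p} ∣p∣≡1 = suc x , refl

∣p∣≡2⇒p≡⁅x⁆∪⁅y⁆ : {p : Subset n} → ∣ p ∣ ≡ 2 → ∃₂ λ x y → x ≢ y × p ≡ ⁅ x ⁆ ∪ ⁅ y ⁆
∣p∣≡2⇒p≡⁅x⁆∪⁅y⁆ {suc n} {inside ∷ p} ∣p∣≡2 with y , refl ← ∣p∣≡1⇒p≡⁅x⁆ {p = p} (suc-injective ∣p∣≡2) =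
  zero , suc y , (λ ()) , cong (inside ∷_) (sym (∪-identityˡ ⁅ y ⁆))
∣p∣≡2⇒p≡⁅x⁆∪⁅y⁆ {p = outside ∷ p} ∣p∣≡2 with x , y , x≢y , refl ← ∣p∣≡2⇒p≡⁅x⁆∪⁅y⁆ {p = p} ∣p∣≡2 =
  suc x , suc y , x≢y ∘ Fin.suc-injective , refl

∣⁅x⁆∪⁅y⁆∣≡2 : {x y : Fin n} → x ≢ y → ∣ ⁅ x ⁆ ∪ ⁅ y ⁆ ∣ ≡ 2
∣⁅x⁆∪⁅y⁆∣≡2 {x = zero} {zero} x≢y = contradiction refl x≢y
∣⁅x⁆∪⁅y⁆∣≡2 {suc n} {zero} {suc y} _ = cong suc (trans (cong ∣_∣ (∪-identityˡ ⁅ y ⁆)) (∣⁅x⁆∣≡1 y))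
∣⁅x⁆∪⁅y⁆∣≡2 {suc n} {suc x} {zero} _ = cong suc (trans (cong ∣_∣ (∪-identityʳ ⁅ x ⁆)) (∣⁅x⁆∣≡1 x))
∣⁅x⁆∪⁅y⁆∣≡2 {x = suc x} {suc y} x≢y = ∣⁅x⁆∪⁅y⁆∣≡2 (x≢y ∘ cong suc)

∈⁅x⁆∪⁅y⁆⇔ : {x y z : Fin n} → z ∈ ⁅ x ⁆ ∪ ⁅ y ⁆ ⇔ (z ≡ x ⊎ z ≡ y)
∈⁅x⁆∪⁅y⁆⇔ = ⇔.trans ∪⇔⊎ (x∈⁅y⁆⇔x≡y ⊎-⇔ x∈⁅y⁆⇔x≡y)

IsPair : Subset n → Set
IsPair p = ∃₂ λ x y → x ≢ y × ∀ z → z ∈ p ⇔ (z ≡ x ⊎ z ≡ y)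

∣p∣≡2⇔IsPair : {p : Subset n} → ∣ p ∣ ≡ 2 ⇔ IsPair p
∣p∣≡2⇔IsPair {p = p} = mk⇔ ∣p∣≡2⇒IsPair IsPair⇒∣p∣≡2
  where
  ∣p∣≡2⇒IsPair : ∣ p ∣ ≡ 2 → IsPair p
  ∣p∣≡2⇒IsPair ∣p∣≡2 with x , y , x≢y , p≡ ← ∣p∣≡2⇒p≡⁅x⁆∪⁅y⁆ {p = p} ∣p∣≡2 =
    x , y , x≢y , λ z → subst (λ q → z ∈ q ⇔ (z ≡ x ⊎ z ≡ y)) (sym p≡) ∈⁅x⁆∪⁅y⁆⇔
  IsPair⇒∣p∣≡2 : IsPair p → ∣ p ∣ ≡ 2
  IsPair⇒∣p∣≡2 (x , y , x≢y , ∈p⇔) = trans (cong ∣_∣ p≡⁅x⁆∪⁅y⁆) (∣⁅x⁆∪⁅y⁆∣≡2 x≢y)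
    where
    p≡⁅x⁆∪⁅y⁆ : p ≡ ⁅ x ⁆ ∪ ⁅ y ⁆
    p≡⁅x⁆∪⁅y⁆ = ⊆-antisym (λ {z} → from ∈⁅x⁆∪⁅y⁆⇔ ∘ to (∈p⇔ z)) (λ {z} → from (∈p⇔ z) ∘ to ∈⁅x⁆∪⁅y⁆⇔)

-- Degrees

∃≢ : 2 ≤ n → (v : Fin n) → ∃ λ u → u ≢ v
∃≢ {suc zero} (s≤s ()) _
∃≢ {suc (suc n)} _ v = punchIn v zero , punchInᵢ≢i v zero

module _ {n m k : ℕ} (H : Hypergraph n m k) where
  open Hypergraph H

  edgesAt : Fin n → Subset m
  edgesAt v = tabulate (λ e → lookup (edge e) v)

  ∈edgesAt⇔ : ∀ {v e} → e ∈ edgesAt v ⇔ _∈ₑ_ H v e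
  ∈edgesAt⇔ {v} {e} = mk⇔
    (λ e∈ → lookup⇒[]= v (edge e) (trans (sym (lookup∘tabulate _ e)) ([]=⇒lookup e∈)))
    (λ v∈ → lookup⇒[]= e (edgesAt v) (trans (lookup∘tabulate _ e) ([]=⇒lookup v∈)))

  deg≡∑ : ∀ v → deg H v ≡ ∑ (λ e → χ (lookup (edge e) v))
  deg≡∑ v = foldr-map-allFin _+_ 0 (λ e → χ (lookup (edge e) v))

  deg≡∣edgesAt∣ : ∀ v → deg H v ≡ ∣ edgesAt v ∣
  deg≡∣edgesAt∣ v = begin
    deg H v                                 ≡⟨ deg≡∑ v ⟩
    ∑ (λ e → χ (lookup (edge e) v))         ≡⟨ ∑-cong {m} (λ e → cong χ (lookup∘tabulate _ e)) ⟨
    ∑ (χ ∘ lookup (edgesAt v))              ≡⟨ ∣p∣≡∑χ (edgesAt v) ⟨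
    ∣ edgesAt v ∣                           ∎
    where open ≡-Reasoning

  exp2h≡∏ : exp2h H ≡ ∏ (λ v → deg H v ^ deg H v)
  exp2h≡∏ = foldr-map-allFin _*_ 1 (λ v → deg H v ^ deg H v)

  handshake : ∑ (deg H) ≡ m * k
  handshake = begin
    ∑ (deg H)                                      ≡⟨ ∑-cong {n} deg≡∑ ⟩
    ∑[ v < n ] ∑[ e < m ] χ (lookup (edge e) v)    ≡⟨ ∑-comm (λ v e → χ (lookup (edge e) v)) ⟩
    ∑[ e < m ] ∑[ v < n ] χ (lookup (edge e) v)    ≡⟨ ∑-cong {m} (λ e → trans (sym (∣p∣≡∑χ (edge e))) (uniform e)) ⟩
    ∑ {m} (λ _ → k)                                ≡⟨ ∑-const {m} k ⟩
    m * k                                          ∎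
    where open ≡-Reasoning

  deg≤m : ∀ v → deg H v ≤ m
  deg≤m v = subst (_≤ m) (sym (deg≡∣edgesAt∣ v)) (∣p∣≤n (edgesAt v))

  deg>0 : Connected H → 2 ≤ n → ∀ v → 0 < deg H v
  deg>0 connected 2≤n v with u , u≢v ← ∃≢ 2≤n v with connected v u
  ... | [] = contradiction refl u≢v
  ... | step e v∈e _ _ = subst (0 <_) (sym (deg≡∣edgesAt∣ v))
          (≤-<-trans z≤n (x∈p⇒∣p-x∣<∣p∣ (from ∈edgesAt⇔ v∈e)))

  deg≡m⇔∀∈ₑ : ∀ v → deg H v ≡ m ⇔ (∀ e → _∈ₑ_ H v e)
  deg≡m⇔∀∈ₑ v rewrite deg≡∣edgesAt∣ v = mk⇔
    (λ ∣∣≡m e → to ∈edgesAt⇔ (to ∣p∣≡n⇔∀∈ ∣∣≡m e))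
    (λ ∀∈ₑ → from ∣p∣≡n⇔∀∈ (λ e → from ∈edgesAt⇔ (∀∈ₑ e)))

  deg≡2⇔inTwoEdges : ∀ w → deg H w ≡ 2 ⇔ ∃₂ λ e₁ e₂ → e₁ ≢ e₂ × ∀ e → _∈ₑ_ H w e ⇔ (e ≡ e₁ ⊎ e ≡ e₂)
  deg≡2⇔inTwoEdges w rewrite deg≡∣edgesAt∣ w = mk⇔
    (λ ∣∣≡2 → let e₁ , e₂ , e₁≢e₂ , ∈⇔ = to ∣p∣≡2⇔IsPair ∣∣≡2 in
      e₁ , e₂ , e₁≢e₂ , λ e → ⇔.trans (⇔.sym ∈edgesAt⇔) (∈⇔ e))
    (λ (e₁ , e₂ , e₁≢e₂ , ∈ₑ⇔) → from ∣p∣≡2⇔IsPair (e₁ , e₂ , e₁≢e₂ , λ e → ⇔.trans ∈edgesAt⇔ (∈ₑ⇔ e)))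

-- H has m = suc s edges of size suc k, so edge-count is the relation m (k - 1) = n.
module ExcessDegrees {n s k} (H : Hypergraph n (suc s) (suc k)) (connected : Connected H) (2≤n : 2 ≤ n)
                     (edge-count : suc s * k ≡ n) where

  excess : Vector ℕ n
  excess v = pred (deg H v)

  deg≡1+excess : ∀ v → deg H v ≡ suc (excess v)
  deg≡1+excess v = sym (suc-pred (deg H v) {{>-nonZero (deg>0 H connected 2≤n v)}})

  ∑excess≡m : ∑ excess ≡ suc s
  ∑excess≡m = +-cancelˡ-≡ n _ _ (begin
    n + ∑ excess             ≡⟨ ∑-suc excess ⟨
    ∑ (λ v → suc (excess v)) ≡⟨ ∑-cong {n} (sym ∘ deg≡1+excess) ⟩
    ∑ (deg H)                ≡⟨ handshake H ⟩
    suc s * suc k            ≡⟨ *-suc (suc s) k ⟩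
    suc s + suc s * k        ≡⟨ cong (suc s +_) edge-count ⟩
    suc s + n                ≡⟨ +-comm (suc s) n ⟩
    n + suc s                ∎)
    where open ≡-Reasoning

  excess≤s : ∀ v → excess v ≤ s
  excess≤s v = ≤-pred (subst (_≤ suc s) (deg≡1+excess v) (deg≤m H v))

  exp2h≡∏selfPow : exp2h H ≡ ∏ (selfPow ∘ excess)
  exp2h≡∏selfPow = trans (exp2h≡∏ H) (∏-cong {n} (λ v → cong (λ d → d ^ d) (deg≡1+excess v)))

  maxDegree2⇔excess≤1 : MaxDegreeIs H 2 ⇔ (∀ v → excess v ≤ 1)
  maxDegree2⇔excess≤1 = mk⇔
    (λ (deg≤2 , _) v → ≤-pred (subst (_≤ 2) (deg≡1+excess v) (deg≤2 v)))
    (λ excess≤1 → (λ v → subst (_≤ 2) (sym (deg≡1+excess v)) (s≤s (excess≤1 v))) ,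
       let v , excessᵥ>0 = ∑>0⇒∃>0 excess (subst (0 <_) (sym ∑excess≡m) z<s)
       in v , trans (deg≡1+excess v) (cong suc (≤-antisym (excess≤1 v) excessᵥ>0)))

  IsHII⇔HIIProfile : IsHII H ⇔ HIIProfile s excess
  IsHII⇔HIIProfile = mk⇔
    (λ (v , w , e₁ , e₂ , w≢v , e₁≢e₂ , v∈all , w∈⇔ , deg≡1) →
      v , w , w≢v ∘ sym , excess≡ v (from (deg≡m⇔∀∈ₑ H v) v∈all) ,
      excess≡ w (from (deg≡2⇔inTwoEdges H w) (e₁ , e₂ , e₁≢e₂ , w∈⇔)) ,
      λ u u≢v u≢w → excess≡ u (deg≡1 u u≢v u≢w))
    (λ (v , w , v≢w , excessᵥ≡s , excess_w≡1 , excess≡0) →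
      let e₁ , e₂ , e₁≢e₂ , w∈⇔ = to (deg≡2⇔inTwoEdges H w) (deg≡ w excess_w≡1) in
      v , w , e₁ , e₂ , v≢w ∘ sym , e₁≢e₂ , to (deg≡m⇔∀∈ₑ H v) (deg≡ v excessᵥ≡s) , w∈⇔ ,
      λ u u≢v u≢w → deg≡ u (excess≡0 u u≢v u≢w))
    where
    excess≡ : ∀ v {d} → deg H v ≡ suc d → excess v ≡ d
    excess≡ v deg≡ = suc-injective (trans (sym (deg≡1+excess v)) deg≡)
    deg≡ : ∀ v {d} → excess v ≡ d → deg H v ≡ suc d
    deg≡ v excess≡ = trans (deg≡1+excess v) (cong suc excess≡)

lemma5 : ∀ {n m k : ℕ} → 3 ≤ k → 2 ≤ m → (H : Hypergraph n m k) →
    Unicyclic H → m * (k ∸ 1) ≡ n →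
    ((4 ^ m ≤ exp2h H) × (exp2h H ≡ 4 ^ m ⇔ MaxDegreeIs H 2)) ×
    ((exp2h H ≤ (m ^ m) * 4) × (exp2h H ≡ (m ^ m) * 4 ⇔ IsHII H))
lemma5 {n} {m@(suc s)} {suc k} (s≤s (s≤s (s≤s _))) 2≤m@(s≤s (s≤s _)) H (connected , _) edge-count =
  ( subst₂ _≤_ (cong (4 ^_) ∑excess≡m) (sym exp2h≡∏selfPow) (4^∑≤∏selfPow excess)
  , ⇔.trans (≡-resp-⇔ exp2h≡∏selfPow (cong (4 ^_) (sym ∑excess≡m)))
            (⇔.trans (∏selfPow≡4^∑⇔≤1 excess) (⇔.sym maxDegree2⇔excess≤1)) ) ,
  ( subst₂ _≤_ (sym exp2h≡∏selfPow) (*-comm 4 (m ^ m)) (∏selfPow≤4*selfPow s excess ∑excess≡m excess≤s)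
  , ⇔.trans (≡-resp-⇔ exp2h≡∏selfPow (*-comm (m ^ m) 4))
            (⇔.trans (∏selfPow≡4*selfPow⇔HIIProfile s excess ∑excess≡m excess≤s) (⇔.sym IsHII⇔HIIProfile)) )
  where
  2≤n : 2 ≤ n
  2≤n = subst (2 ≤_) edge-count (*-mono-≤ {2} {m} {1} {k} 2≤m (s≤s z≤n))
  open ExcessDegrees H connected 2≤n edge-count
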